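{- Let $G=(V,E)$ be a source graph, $s>1$, $H_j\in\mathcal{H}_s$, and $v\in V$. If $g(H_i\mid G)(v)<\mathbf{U}_s(i,j)$ for some $H_i\in\mathcal{H}_s$ with $H_i\prec H_j$, then $f(H_j\mid G)(v)=0$. (The thresholds $\mathbf{U}_s(i,j)$ are independent of the source graph.)
   Context: All graphs are finite, undirected and simple. For a connected graph $H$, the automorphism group partitions $V(H)$ into orbits. A graphlet $H_\sigma$ is a connected graph $H$ (up to isomorphism) with one designated orbit $\sigma$; $\mathcal{H}_s$ is the finite set of all graphlets with $s$ nodes (identified up to isomorphisms preserving the designated orbit). $H_i\prec H_j$ means the graph underlying $H_i$ is a proper subgraph of the graph underlying $H_j$. For a graph $G$, $v\in V(G)$ and graphlet $H_\sigma$: the gross count $g(H_\sigma\mid G)(v)$ is the number of distinct (not necessarily induced) subgraphs $H'$ of $G$ isomorphic to $H$ via an isomorphism under which $v$ lies in the orbit of $H'$ corresponding to $\sigma$; the net count $f(H_\sigma\mid G)(v)$ is the number of such $H'$ that are induced subgraphs of $G$. $\mathbf{U}_s$ is the matrix indexed by $\mathcal{H}_s\times\mathcal{H}_s$ with $\mathbf{U}_s(i,j)=g(H_i\mid H_j)(v')$, where $v'$ is a vertex in the designated orbit of $H_j$ (regarding $H_j$ as a source graph). -}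

module Defs where

open import Data.Bool using (Bool; true; false; _∧_; _∨_; not; if_then_else_)
open import Data.Bool.Properties using () renaming (_≟_ to _≟ᵇ_)
open import Data.Nat using (ℕ; zero; suc)
open import Data.Fin using (Fin; _≟_)
open import Data.List using (List; []; _∷_; map; concatMap; filter; length; deduplicate; allFin)
open import Data.Bool.ListAction using (any; all)
open import Data.Vec using (Vec; tabulate; lookup) renaming ([] to []ᵥ; _∷_ to _∷ᵥ_)
import Data.Vec.Properties as VecP
import Data.Product.Properties as ProdP
open import Data.Product using (Σ; _×_; _,_)
open import Relation.Nullary using (¬_; does)
open import Relation.Binary.PropositionalEquality using (_≡_)
open import Relation.Binary.Definitions using (DecidableEquality)

record Graph (n : ℕ) : Set where
  field
    adj    : Fin n → Fin n → Bool
    sym    : ∀ i j → adj i j ≡ adj j i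
    irrefl : ∀ i → adj i i ≡ false
open Graph public

data Reach {n : ℕ} (G : Graph n) : Fin n → Fin n → Set where
  here : ∀ {i} → Reach G i i
  step : ∀ {i j k} → adj G i j ≡ true → Reach G j k → Reach G i k

Connected : ∀ {n} → Graph n → Set
Connected G = ∀ i j → Reach G i j

allMaps : (k n : ℕ) → List (Vec (Fin n) k)
allMaps zero    n = []ᵥ ∷ []
allMaps (suc k) n = concatMap (λ i → map (i ∷ᵥ_) (allMaps k n)) (allFin n)

_==_ : ∀ {n} → Fin n → Fin n → Bool
a == b = does (a ≟ b)

anyFin : ∀ {n} → (Fin n → Bool) → Bool
anyFin {n} p = any p (allFin n)

allFin? : ∀ {n} → (Fin n → Bool) → Bool
allFin? {n} p = all p (allFin n)

_⇒ᵇ_ : Bool → Bool → Bool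
a ⇒ᵇ b = not a ∨ b

isInjective : ∀ {k n} → Vec (Fin n) k → Bool
isInjective φ = allFin? λ a → allFin? λ b → (lookup φ a == lookup φ b) ⇒ᵇ (a == b)

isEmb : ∀ {k n} → Graph k → Graph n → Vec (Fin n) k → Bool
isEmb H G φ = isInjective φ ∧
  (allFin? λ a → allFin? λ b → adj H a b ⇒ᵇ adj G (lookup φ a) (lookup φ b))

isInducedEmb : ∀ {k n} → Graph k → Graph n → Vec (Fin n) k → Bool
isInducedEmb H G φ = isEmb H G φ ∧
  (allFin? λ a → allFin? λ b → adj G (lookup φ a) (lookup φ b) ⇒ᵇ adj H a b)

-- automorphism of H (an injective self-map of a finite set is a bijection)
isAut : ∀ {k} → Graph k → Vec (Fin k) k → Bool
isAut H π = isInducedEmb H H π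

inOrbit : ∀ {k} → Graph k → Fin k → Fin k → Bool
inOrbit {k} H r u = any (λ π → isAut H π ∧ (lookup π r == u)) (allMaps k k)

-- Subgraphs of a graph on Fin n, given by vertex set and edge set

Subgraph : ℕ → Set
Subgraph n = Vec Bool n × Vec (Vec Bool n) n

_≟S_ : ∀ {n} → DecidableEquality (Subgraph n)
_≟S_ = ProdP.≡-dec (VecP.≡-dec _≟ᵇ_) (VecP.≡-dec (VecP.≡-dec _≟ᵇ_))

image : ∀ {k n} → Graph k → Vec (Fin n) k → Subgraph n
image H φ =
  tabulate (λ w → anyFin λ a → lookup φ a == w) ,
  tabulate (λ x → tabulate (λ y → anyFin λ a → anyFin λ b →
      adj H a b ∧ (lookup φ a == x) ∧ (lookup φ b == y)))

whole : ∀ {n} → Graph n → Subgraph n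
whole G = tabulate (λ _ → true) , tabulate (λ x → tabulate (λ y → adj G x y))

-- Graphlets: connected graph on s nodes with a designated orbit,
-- represented by one of its vertices `root` (orbit σ = orbit of root).

record Graphlet (s : ℕ) : Set where
  field
    graph     : Graph s
    connected : Connected graph
    root      : Fin s
open Graphlet public

inσ : ∀ {s} → Graphlet s → Fin s → Bool
inσ Hσ u = inOrbit (graph Hσ) (root Hσ) u

rootedEmbs : ∀ {s n} → Graphlet s → Graph n → Fin n → List (Vec (Fin n) s)
rootedEmbs {s} {n} Hσ G v =
  filter (λ φ → Data.Bool.T? (isEmb (graph Hσ) G φ ∧
                   anyFin (λ u → inσ Hσ u ∧ (lookup φ u == v))))
         (allMaps s n)
  where import Data.Bool

-- gross count g(Hσ | G)(v): number of distinct subgraphs H' of G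
-- isomorphic to H with v in the orbit of H' corresponding to σ
gross : ∀ {s n} → Graphlet s → Graph n → Fin n → ℕ
gross Hσ G v = length (deduplicate _≟S_ (map (image (graph Hσ)) (rootedEmbs Hσ G v)))

net : ∀ {s n} → Graphlet s → Graph n → Fin n → ℕ
net Hσ G v = length (deduplicate _≟S_ (map (image (graph Hσ))
  (filter (λ φ → Data.Bool.T? (isInducedEmb (graph Hσ) G φ)) (rootedEmbs Hσ G v))))
  where import Data.Bool

U : ∀ {s} → Graphlet s → Graphlet s → ℕ
U Hi Hj = gross Hi (graph Hj) (root Hj)

_≺_ : ∀ {s t} → Graphlet s → Graphlet t → Set
_≺_ {s} {t} Hi Hj = Σ (Vec (Fin t) s) λ φ →
  (isEmb (graph Hi) (graph Hj) φ ≡ true) × ¬ (image (graph Hi) φ ≡ whole (graph Hj))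

-- If G contains a copy of Hj (induced or not) with v in the designated orbit, an automorphism of
-- Hj moves the root onto the preimage of v, so composing gives an embedding τ : Hj → G with
-- τ(root) = v.  Composition with τ sends every copy of Hi in Hj counted by U(i, j) to a copy of Hi
-- in G counted by g(Hi | G)(v), and distinct copies stay distinct because restricting along the
-- injective τ recovers the original copy.  Hence g(Hi | G)(v) ≥ U(i, j), and the hypothesis
-- g(Hi | G)(v) < U(i, j) rules out any copy of Hj at v.
module Submission where

open import Defs hiding (sym)
open import Data.Bool using (Bool; true; false; T; T?; _∧_)
open import Data.Bool.ListAction using (or)
open import Data.Bool.Properties using (T-∧)
open import Data.Nat using (ℕ; _<_; _≤_)
open import Data.Nat.Properties using (<⇒≱; module ≤-Reasoning)
open import Data.Fin using (Fin; zero; suc; _≟_)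
open import Data.Fin.Properties using (injective⇒≤)
open import Data.Product using (∃; _×_; _,_; proj₁; proj₂)
open import Data.List using (List; []; _∷_; map; length; deduplicate; allFin; lookup)
open import Data.List.Properties using (map-cong; length-map)
open import Data.List.Relation.Unary.Any using (here; satisfied; index)
import Data.List.Relation.Unary.Any as Any
import Data.List.Relation.Unary.All as All
open import Data.List.Relation.Unary.Any.Properties using (any⁺; any⁻; lookup-index)
open import Data.List.Relation.Unary.All.Properties using (all⁺; all⁻)
open import Data.List.Relation.Unary.AllPairs using (_∷_)
open import Data.List.Relation.Unary.Unique.Propositional using (Unique)
open import Data.List.Relation.Unary.Unique.DecPropositional.Properties using (deduplicate-!)
open import Data.List.Relation.Binary.Subset.Propositional using (_⊆_)
open import Data.List.Membership.Propositional using (_∈_; _∉_; lose)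
open import Data.List.Membership.Propositional.Properties
  using (∈-allFin; ∈-lookup; ∈-concatMap⁺; ∈-map⁺; ∈-map⁻; ∈-filter⁺; ∈-filter⁻;
         ∈-deduplicate⁺; ∈-deduplicate⁻)
open import Data.Vec using (Vec; tabulate) renaming (lookup to lookupᵥ; map to mapᵥ; [] to []ᵥ; _∷_ to _∷ᵥ_)
open import Data.Vec.Properties using (lookup-map; lookup∘tabulate; tabulate-cong)
open import Data.Empty using (⊥-elim)
open import Function using (_∘_; _⇔_; mk⇔; Equivalence)
open import Relation.Nullary using (yes)
open import Relation.Nullary.Decidable using (dec-true; does-⇔)
open import Relation.Binary.PropositionalEquality
  using (_≡_; _≗_; refl; sym; trans; cong; cong₂; subst; module ≡-Reasoning)

open Equivalence using (to; from)

private
  variable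
    k n s t : ℕ

T-⇒ᵇ : ∀ {a b} → T (a ⇒ᵇ b) ⇔ (T a → T b)
T-⇒ᵇ {false} = mk⇔ (λ _ ()) _
T-⇒ᵇ {true}  = mk⇔ (λ b _ → b) (λ f → f _)

T-== : {a b : Fin n} → T (a == b) ⇔ a ≡ b
T-== {a = a} {b} = mk⇔ sound (λ a≡b → subst T (sym (dec-true (a ≟ b) a≡b)) _)
  where
  sound : T (a == b) → a ≡ b
  sound t with a ≟ b
  ... | yes a≡b = a≡b

==-cong-injective : (f : Fin k → Fin n) → (∀ {a b} → f a ≡ f b → a ≡ b) →
                    ∀ a b → (f a == f b) ≡ (a == b)
==-cong-injective f f-inj a b = does-⇔ (mk⇔ f-inj (cong f)) (f a ≟ f b) (a ≟ b)

T-allFin? : {p : Fin n → Bool} → T (allFin? p) ⇔ (∀ x → T (p x))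
T-allFin? {n} {p} = mk⇔
  (λ t x → All.lookup (all⁺ p (allFin n) t) (∈-allFin x))
  (λ h → all⁻ p {allFin n} (All.tabulate (λ {x} _ → h x)))

T-allFin²-⇒ᵇ : (p q : Fin k → Fin n → Bool) →
               T (allFin? λ a → allFin? λ b → p a b ⇒ᵇ q a b) ⇔ (∀ {a b} → T (p a b) → T (q a b))
T-allFin²-⇒ᵇ p q = mk⇔
  (λ t {a} {b} → to (T-⇒ᵇ {p a b}) (to T-allFin? (to T-allFin? t a) b))
  (λ h → from T-allFin? λ a → from T-allFin? λ b → from (T-⇒ᵇ {p a b}) h)

T-anyFin : {p : Fin n → Bool} → T (anyFin p) ⇔ ∃ (T ∘ p)
T-anyFin {n} {p} = mk⇔
  (λ t → satisfied (any⁻ p (allFin n) t))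
  (λ (x , px) → any⁺ p (lose (∈-allFin x) px))

anyFin-cong : {p q : Fin n → Bool} → p ≗ q → anyFin p ≡ anyFin q
anyFin-cong {n} p≗q = cong or (map-cong p≗q (allFin n))

allMaps-complete : (φ : Vec (Fin n) k) → φ ∈ allMaps k n
allMaps-complete []ᵥ = here refl
allMaps-complete {n} (i ∷ᵥ φ) =
  ∈-concatMap⁺ (λ j → map (j ∷ᵥ_) (allMaps _ n))
    (Any.map (λ { refl → ∈-map⁺ (i ∷ᵥ_) (allMaps-complete φ) }) (∈-allFin i))

record IsEmbedding (H : Graph k) (G : Graph n) (f : Fin k → Fin n) : Set where
  field
    injective     : ∀ {a b} → f a ≡ f b → a ≡ b
    preserves-adj : ∀ {a b} → T (adj H a b) → T (adj G (f a) (f b))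
open IsEmbedding

IsEmbedding-∘ : {H : Graph k} {K : Graph t} {G : Graph n}
                {f : Fin k → Fin t} {g : Fin t → Fin n} →
                IsEmbedding K G g → IsEmbedding H K f → IsEmbedding H G (g ∘ f)
IsEmbedding-∘ g-emb f-emb = record
  { injective     = injective f-emb ∘ injective g-emb
  ; preserves-adj = preserves-adj g-emb ∘ preserves-adj f-emb
  }

IsEmbedding-resp-≗ : {H : Graph k} {G : Graph n} {f g : Fin k → Fin n} →
                     f ≗ g → IsEmbedding H G f → IsEmbedding H G g
IsEmbedding-resp-≗ {G = G} f≗g f-emb = record
  { injective     = λ {a} {b} ga≡gb → injective f-emb (trans (f≗g a) (trans ga≡gb (sym (f≗g b))))
  ; preserves-adj = λ {a} {b} → subst T (cong₂ (adj G) (f≗g a) (f≗g b)) ∘ preserves-adj f-emb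
  }

T-isEmb : {H : Graph k} {G : Graph n} {φ : Vec (Fin n) k} →
          T (isEmb H G φ) ⇔ IsEmbedding H G (lookupᵥ φ)
T-isEmb {k} {H = H} {G} {φ} = mk⇔
  (λ t → let inj , adj-pres = to (T-∧ {isInjective φ}) t in record
    { injective     = to T-== ∘ to (T-allFin²-⇒ᵇ φ== _==_) inj ∘ from T-==
    ; preserves-adj = to (T-allFin²-⇒ᵇ (adj H) adjG) adj-pres
    })
  (λ emb → from T-∧ ( from (T-allFin²-⇒ᵇ φ== _==_) (from T-== ∘ injective emb ∘ to T-==)
                    , from (T-allFin²-⇒ᵇ (adj H) adjG) (preserves-adj emb)))
  where
  φ== adjG : Fin k → Fin k → Bool
  φ== a b = lookupᵥ φ a == lookupᵥ φ b
  adjG a b = adj G (lookupᵥ φ a) (lookupᵥ φ b)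

inOrbit⇒embedding : {H : Graph k} {r u : Fin k} → T (inOrbit H r u) →
                    ∃ λ π → IsEmbedding H H (lookupᵥ π) × lookupᵥ π r ≡ u
inOrbit⇒embedding {k} {H = H} {r} {u} t =
  let π , aut-π = satisfied (any⁻ (λ π → isAut H π ∧ (lookupᵥ π r == u)) (allMaps k k) t)
      induced , πr≡u = to (T-∧ {isAut H π}) aut-π
  in π , to (T-isEmb {φ = π}) (proj₁ (to (T-∧ {isEmb H H π}) induced)) , to T-== πr≡u

record IsRootedEmbedding (Hσ : Graphlet s) (G : Graph n) (v : Fin n) (f : Fin s → Fin n) : Set where
  field
    isEmbedding : IsEmbedding (graph Hσ) G f
    anchor      : Fin s
    anchor∈σ    : T (inσ Hσ anchor)
    anchor↦v    : f anchor ≡ v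
open IsRootedEmbedding

∈-rootedEmbs : {Hσ : Graphlet s} {G : Graph n} {v : Fin n} {φ : Vec (Fin n) s} →
               φ ∈ rootedEmbs Hσ G v ⇔ IsRootedEmbedding Hσ G v (lookupᵥ φ)
∈-rootedEmbs {s} {n} {Hσ} {G} {v} {φ} = mk⇔
  (λ φ∈ → let emb , rooted = to (T-∧ {isEmb (graph Hσ) G φ})
                                 (proj₂ (∈-filter⁻ P? {xs = allMaps s n} φ∈))
              u , u-rooted   = to T-anyFin rooted
              u∈σ , φu≡v     = to (T-∧ {inσ Hσ u}) u-rooted
          in record
               { isEmbedding = to (T-isEmb {φ = φ}) emb
               ; anchor      = u
               ; anchor∈σ    = u∈σ
               ; anchor↦v    = to T-== φu≡v
               })
  (λ rooted → ∈-filter⁺ P? (allMaps-complete φ)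
    (from T-∧ ( from (T-isEmb {φ = φ}) (isEmbedding rooted)
              , from T-anyFin (anchor rooted , from T-∧ (anchor∈σ rooted , from T-== (anchor↦v rooted))))))
  where
  P? = λ (ψ : Vec (Fin n) s) →
         T? (isEmb (graph Hσ) G ψ ∧ anyFin (λ u → inσ Hσ u ∧ (lookupᵥ ψ u == v)))

IsRootedEmbedding-resp-≗ : {Hσ : Graphlet s} {G : Graph n} {v : Fin n} {f g : Fin s → Fin n} →
                           f ≗ g → IsRootedEmbedding Hσ G v f → IsRootedEmbedding Hσ G v g
IsRootedEmbedding-resp-≗ f≗g rooted = record
  { isEmbedding = IsEmbedding-resp-≗ f≗g (isEmbedding rooted)
  ; anchor      = anchor rooted
  ; anchor∈σ    = anchor∈σ rooted
  ; anchor↦v    = trans (sym (f≗g (anchor rooted))) (anchor↦v rooted)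
  }

IsRootedEmbedding-∘ : {Hσ : Graphlet s} {K : Graph t} {G : Graph n} {r : Fin t} {v : Fin n}
                      {τ : Fin t → Fin n} {f : Fin s → Fin t} →
                      IsEmbedding K G τ → τ r ≡ v →
                      IsRootedEmbedding Hσ K r f → IsRootedEmbedding Hσ G v (τ ∘ f)
IsRootedEmbedding-∘ {τ = τ} τ-emb τr≡v rooted = record
  { isEmbedding = IsEmbedding-∘ τ-emb (isEmbedding rooted)
  ; anchor      = anchor rooted
  ; anchor∈σ    = anchor∈σ rooted
  ; anchor↦v    = trans (cong τ (anchor↦v rooted)) τr≡v
  }

rooted⇒root-preserving : {Hσ : Graphlet s} {G : Graph n} {v : Fin n} {f : Fin s → Fin n} →
                         IsRootedEmbedding Hσ G v f →
                         ∃ λ τ → IsEmbedding (graph Hσ) G τ × τ (root Hσ) ≡ v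
rooted⇒root-preserving {f = f} rooted =
  let π , π-emb , π-root≡anchor = inOrbit⇒embedding (anchor∈σ rooted)
  in f ∘ lookupᵥ π , IsEmbedding-∘ (isEmbedding rooted) π-emb
                   , trans (cong f π-root≡anchor) (anchor↦v rooted)

Unique⇒lookup-injective : {A : Set} {xs : List A} → Unique xs →
                          ∀ {i j} → lookup xs i ≡ lookup xs j → i ≡ j
Unique⇒lookup-injective (_ ∷ _)     {zero}  {zero}  _     = refl
Unique⇒lookup-injective (x≢xs ∷ _)  {zero}  {suc j} x≡xⱼ  = ⊥-elim (All.lookup x≢xs (∈-lookup j) x≡xⱼ)
Unique⇒lookup-injective (x≢xs ∷ _)  {suc i} {zero}  xᵢ≡x  = ⊥-elim (All.lookup x≢xs (∈-lookup i) (sym xᵢ≡x))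
Unique⇒lookup-injective (_ ∷ xs!)   {suc i} {suc j} xᵢ≡xⱼ = cong suc (Unique⇒lookup-injective xs! xᵢ≡xⱼ)

Unique-⊆⇒length-≤ : {A : Set} {xs ys : List A} → Unique xs → xs ⊆ ys → length xs ≤ length ys
Unique-⊆⇒length-≤ {xs = xs} {ys} xs! xs⊆ys = injective⇒≤ position-injective
  where
  position : Fin (length xs) → Fin (length ys)
  position i = index (xs⊆ys (∈-lookup i))

  position-injective : ∀ {i j} → position i ≡ position j → i ≡ j
  position-injective {i} {j} eq = Unique⇒lookup-injective xs! (begin
    lookup xs i            ≡⟨ lookup-index (xs⊆ys (∈-lookup i)) ⟩
    lookup ys (position i) ≡⟨ cong (lookup ys) eq ⟩
    lookup ys (position j) ≡⟨ lookup-index (xs⊆ys (∈-lookup j)) ⟨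
    lookup xs j            ∎)
    where open ≡-Reasoning

restrict : (Fin t → Fin n) → Subgraph n → Subgraph t
restrict τ (vs , es) =
  tabulate (λ x → lookupᵥ vs (τ x)) ,
  tabulate (λ x → tabulate (λ y → lookupᵥ (lookupᵥ es (τ x)) (τ y)))

restrict-image : (H : Graph k) {τ : Fin t → Fin n} → (∀ {a b} → τ a ≡ τ b → a ≡ b) →
                 (φ : Vec (Fin t) k) → restrict τ (image H (mapᵥ τ φ)) ≡ image H φ
restrict-image H {τ} τ-inj φ =
  cong₂ _,_ (tabulate-cong vertex) (tabulate-cong λ x → tabulate-cong (edge x))
  where
  hits : ∀ a x → (lookupᵥ (mapᵥ τ φ) a == τ x) ≡ (lookupᵥ φ a == x)
  hits a x = trans (cong (_== τ x) (lookup-map a τ φ)) (==-cong-injective τ τ-inj (lookupᵥ φ a) x)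

  vertex : ∀ x → lookupᵥ (proj₁ (image H (mapᵥ τ φ))) (τ x) ≡ anyFin (λ a → lookupᵥ φ a == x)
  vertex x = trans (lookup∘tabulate _ (τ x)) (anyFin-cong λ a → hits a x)

  edge : ∀ x y → lookupᵥ (lookupᵥ (proj₂ (image H (mapᵥ τ φ))) (τ x)) (τ y)
                 ≡ anyFin (λ a → anyFin λ b → adj H a b ∧ (lookupᵥ φ a == x) ∧ (lookupᵥ φ b == y))
  edge x y =
    trans (cong (λ row → lookupᵥ row (τ y)) (lookup∘tabulate _ (τ x)))
   (trans (lookup∘tabulate _ (τ y))
          (anyFin-cong λ a → anyFin-cong λ b → cong₂ (λ p q → adj H a b ∧ p ∧ q) (hits a x) (hits b y)))

-- Restriction along τ is a left inverse of composition with τ on copies, so it witnesses that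
-- composition does not identify distinct copies.
gross-monotone : (Hσ : Graphlet s) {K : Graph t} {G : Graph n} {r : Fin t} {v : Fin n}
                 {τ : Fin t → Fin n} → IsEmbedding K G τ → τ r ≡ v → gross Hσ K r ≤ gross Hσ G v
gross-monotone Hσ {K} {G} {r} {v} {τ} τ-emb τr≡v = begin
  gross Hσ K r
    ≤⟨ Unique-⊆⇒length-≤ (deduplicate-! _≟S_ (copies K r)) pulled-back ⟩
  length (map (restrict τ) (deduplicate _≟S_ (copies G v)))
    ≡⟨ length-map (restrict τ) (deduplicate _≟S_ (copies G v)) ⟩
  gross Hσ G v
    ∎
  where
  open ≤-Reasoning
  H = graph Hσ

  copies : {m : ℕ} → Graph m → Fin m → List (Subgraph m)
  copies G′ w = map (image H) (rootedEmbs Hσ G′ w)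

  pushed-forward : ∀ {φ} → φ ∈ rootedEmbs Hσ K r →
                   image H (mapᵥ τ φ) ∈ deduplicate _≟S_ (copies G v)
  pushed-forward {φ} φ∈ =
    ∈-deduplicate⁺ _≟S_ (∈-map⁺ (image H) (from (∈-rootedEmbs {φ = mapᵥ τ φ})
      (IsRootedEmbedding-resp-≗ (λ a → sym (lookup-map a τ φ))
        (IsRootedEmbedding-∘ {f = lookupᵥ φ} τ-emb τr≡v
          (to (∈-rootedEmbs {Hσ = Hσ} {K} {r} {φ}) φ∈)))))

  pulled-back : deduplicate _≟S_ (copies K r) ⊆ map (restrict τ) (deduplicate _≟S_ (copies G v))
  pulled-back X∈ =
    let φ , φ∈ , X≡imageφ = ∈-map⁻ (image H) (∈-deduplicate⁻ _≟S_ (copies K r) X∈)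
    in subst (_∈ _) (trans (restrict-image H (injective τ-emb) φ) (sym X≡imageφ))
             (∈-map⁺ (restrict τ) (pushed-forward {φ} φ∈))

∉⇒≡[] : {A : Set} {xs : List A} → (∀ {x} → x ∉ xs) → xs ≡ []
∉⇒≡[] {xs = []}    _  = refl
∉⇒≡[] {xs = x ∷ _} ∉xs = ⊥-elim (∉xs (here refl))

no-rooted-embedding⇒net≡0 : (Hσ : Graphlet s) (G : Graph n) (v : Fin n) →
                            (∀ {ψ} → ψ ∉ rootedEmbs Hσ G v) → net Hσ G v ≡ 0
no-rooted-embedding⇒net≡0 Hσ G v ∉embs =
  cong (λ embs → length (deduplicate _≟S_ (map (image (graph Hσ)) embs)))
       (∉⇒≡[] (∉embs ∘ proj₁ ∘ ∈-filter⁻ (λ φ → T? (isInducedEmb (graph Hσ) G φ))))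

proposition1 : (s : ℕ) → 1 < s → (Hj : Graphlet s) →
    {n : ℕ} (G : Graph n) (v : Fin n) →
    (Hi : Graphlet s) → Hi ≺ Hj → gross Hi G v < U Hi Hj →
    net Hj G v ≡ 0
proposition1 s _ Hj G v Hi _ gross<U = no-rooted-embedding⇒net≡0 Hj G v no-copy
  where
  no-copy : ∀ {ψ} → ψ ∉ rootedEmbs Hj G v
  no-copy {ψ} ψ∈ =
    let τ , τ-emb , τ-root≡v = rooted⇒root-preserving (to (∈-rootedEmbs {Hσ = Hj} {G} {v} {ψ}) ψ∈)
    in <⇒≱ gross<U (gross-monotone Hi τ-emb τ-root≡v)
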